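{- Let $S\neq0$ be a commutative ring, and let $\mathscr{S}_1$ be the set of $|\psi\rangle\in\mathscr{D}$ with $\sum_x\psi_x=1_S$. Then $\mathscr{S}_1$ is a state space.
   Context: $\mathcal{B}=S^{\{0,1\}}$, $\mathscr{D}=S\oplus\mathcal{B}\oplus\mathcal{B}^{\otimes2}\oplus\cdots$ with $\mathcal{B}^{\otimes n}\cong S^{\{0,1\}^n}$ having standard basis $|x\rangle$, $x\in\{0,1\}^n$; elements of $\mathscr{D}$ are finitely supported and $\psi_x$ is the $x$-coefficient of $|\psi\rangle$; $\vec0$ is the zero vector; $\otimes$ is the tensor (Kronecker) product. A state space is a subset $\mathscr{S}\subseteq\mathscr{D}$ such that (1) for $|\psi\rangle\in\mathscr{S}$ and $|\phi\rangle\in\mathscr{D}$, $|\phi\rangle\otimes|\psi\rangle\in\mathscr{S}$ iff $|\phi\rangle\in\mathscr{S}$, and $|\psi\rangle\otimes|\phi\rangle\in\mathscr{S}$ iff $|\phi\rangle\in\mathscr{S}$; (2) $\mathscr{S}$ contains $|x\rangle$ for every $x\in\{0,1\}^*$ and does not contain $\vec0$. -}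

module Defs where

open import Level using (Level; _⊔_) renaming (suc to lsuc)
open import Algebra.Bundles using (CommutativeRing)
open import Data.Bool using (Bool; true; false)
open import Data.Bool.Properties using () renaming (_≟_ to _≟B_)
open import Data.List using (List; []; _∷_; _++_; map; foldr; concatMap)
open import Data.List.Properties using (≡-dec)
open import Data.Nat using (ℕ; zero; suc) renaming (_⊔_ to _⊔ℕ_)
open import Data.Product using (_×_; _,_)
open import Relation.Nullary using (¬_; yes; no)
open import Function.Bundles using (_⇔_)

-- Binary words x ∈ {0,1}^* ; the basis vector |x⟩ of B^{⊗n}, n = length x.
Word : Set
Word = List Bool

wordsOfLength : ℕ → List Word
wordsOfLength zero    = [] ∷ []
wordsOfLength (suc n) = map (false ∷_) (wordsOfLength n) ++ map (true ∷_) (wordsOfLength n)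

module _ {c ℓ : Level} (R : CommutativeRing c ℓ) where
  open CommutativeRing R renaming (Carrier to S)

  -- An element of 𝒟 = S ⊕ B ⊕ B^{⊗2} ⊕ ⋯ (finitely supported), written as a
  -- finite formal linear combination  Σ a |x⟩  of basis vectors |x⟩, x ∈ {0,1}^*.
  D : Set c
  D = List (Word × S)

  coeff : D → Word → S
  coeff []            x = 0#
  coeff ((y , a) ∷ ψ) x with ≡-dec _≟B_ y x
  ... | yes _ = a + coeff ψ x
  ... | no  _ = coeff ψ x

  _≈D_ : D → D → Set ℓ
  ψ ≈D φ = ∀ x → coeff ψ x ≈ coeff φ x

  zeroD : D
  zeroD = []

  ket : Word → D
  ket x = (x , 1#) ∷ []

  -- tensor (Kronecker) product: |x⟩ ⊗ |y⟩ = |xy⟩, extended bilinearly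
  _⊗_ : D → D → D
  φ ⊗ ψ = concatMap (λ { (x , a) → map (λ { (y , b) → (x ++ y , a * b) }) ψ }) φ

  lenBound : D → ℕ
  lenBound []            = 0
  lenBound ((x , _) ∷ ψ) = Data.List.length x ⊔ℕ lenBound ψ

  sumS : List S → S
  sumS = foldr _+_ 0#

  -- Σ_{x ∈ {0,1}^*} ψ_x  (all coefficients with length x > lenBound ψ vanish)
  totalSum : D → S
  totalSum ψ = sumS (concatMap (λ n → map (coeff ψ) (wordsOfLength n))
                               (Data.List.upTo (suc (lenBound ψ))))

  record IsStateSpace {p : Level} (P : D → Set p) : Set (c ⊔ ℓ ⊔ p) where
    field
      respects : ∀ ψ φ → ψ ≈D φ → P ψ → P φ
      tensorˡ  : ∀ ψ φ → P ψ → (P (φ ⊗ ψ) ⇔ P φ)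
      tensorʳ  : ∀ ψ φ → P ψ → (P (ψ ⊗ φ) ⇔ P φ)
      basis    : ∀ x → P (ket x)
      noZero   : ∀ ψ → ψ ≈D zeroD → ¬ P ψ

  S₁ : D → Set ℓ
  S₁ ψ = totalSum ψ ≈ 1#

module Submission where

open import Defs
open import Level using (Level)
open import Algebra.Bundles using (CommutativeRing)
open import Relation.Nullary using (¬_; yes; no; does)
open import Data.Bool using (Bool; true; false; if_then_else_)
open import Data.Bool.Properties using () renaming (_≟_ to _≟B_)
open import Data.List using (List; []; _∷_; _++_; map; concatMap; upTo; length)
open import Data.List.Properties using (≡-dec; map-concatMap; map-applyUpTo)
open import Data.Nat using (ℕ; zero; suc; _<_; _≡ᵇ_; s≤s) renaming (_⊔_ to _⊔ℕ_)
open import Data.Nat.Properties using (n<1+n; m⊔n<o⇒m<o; m⊔n<o⇒n<o; m≤m⊔n; m≤n⊔m)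
open import Data.Product using (_,_; proj₂)
open import Function.Bundles using (_⇔_; mk⇔)
open import Relation.Binary.PropositionalEquality as ≡ using (_≡_)
import Relation.Binary.Reasoning.Setoid as SetoidReasoning
import Algebra.Properties.CommutativeSemigroup as CommSemigroupProperties

-- Σ_x ψ_x is the plain sum of the coefficients listed in the formal combination ψ,
-- because the words of length ≤ lenBound ψ are enumerated exactly once each.  That
-- "weight" is invariant under ≈D, multiplicative for ⊗, equal to 1 on |x⟩ and to 0
-- on 0⃗, so a state of weight 1 can be tensored on or cancelled at will; 1 ≉ 0 is
-- needed only to keep 0⃗ out.

module _ {c ℓ : Level} (R : CommutativeRing c ℓ) where
  open CommutativeRing R renaming (Carrier to S)
  open SetoidReasoning setoid
  open CommSemigroupProperties +-commutativeSemigroup using (interchange)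

  Σ : ∀ {a} {A : Set a} → List A → (A → S) → S
  Σ xs f = sumS R (map f xs)

  Σ-cong : ∀ {a} {A : Set a} (xs : List A) {f g : A → S} →
           (∀ x → f x ≈ g x) → Σ xs f ≈ Σ xs g
  Σ-cong []       f≈g = refl
  Σ-cong (x ∷ xs) f≈g = +-cong (f≈g x) (Σ-cong xs f≈g)

  Σ-zero : ∀ {a} {A : Set a} (xs : List A) → Σ xs (λ _ → 0#) ≈ 0#
  Σ-zero []       = refl
  Σ-zero (x ∷ xs) = trans (+-identityˡ _) (Σ-zero xs)

  Σ-+ : ∀ {a} {A : Set a} (xs : List A) (f g : A → S) →
        Σ xs (λ x → f x + g x) ≈ Σ xs f + Σ xs g
  Σ-+ []       f g = sym (+-identityˡ 0#)
  Σ-+ (x ∷ xs) f g = trans (+-cong refl (Σ-+ xs f g)) (interchange _ _ _ _)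

  Σ-distribˡ : ∀ {a} {A : Set a} (xs : List A) (r : S) (f : A → S) →
               Σ xs (λ x → r * f x) ≈ r * Σ xs f
  Σ-distribˡ []       r f = sym (zeroʳ r)
  Σ-distribˡ (x ∷ xs) r f = trans (+-cong refl (Σ-distribˡ xs r f)) (sym (distribˡ r _ _))

  Σ-distribʳ : ∀ {a} {A : Set a} (xs : List A) (r : S) (f : A → S) →
               Σ xs (λ x → f x * r) ≈ Σ xs f * r
  Σ-distribʳ []       r f = sym (zeroˡ r)
  Σ-distribʳ (x ∷ xs) r f = trans (+-cong refl (Σ-distribʳ xs r f)) (sym (distribʳ r _ _))

  Σ-++ : ∀ {a} {A : Set a} (xs ys : List A) (f : A → S) → Σ (xs ++ ys) f ≈ Σ xs f + Σ ys f
  Σ-++ []       ys f = sym (+-identityˡ _)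
  Σ-++ (x ∷ xs) ys f = trans (+-cong refl (Σ-++ xs ys f)) (sym (+-assoc _ _ _))

  Σ-map : ∀ {a b} {A : Set a} {B : Set b} (xs : List A) (h : A → B) (f : B → S) →
          Σ (map h xs) f ≡ Σ xs (λ x → f (h x))
  Σ-map []       h f = ≡.refl
  Σ-map (x ∷ xs) h f = ≡.cong (f (h x) +_) (Σ-map xs h f)

  Σ-concatMap : ∀ {a b} {A : Set a} {B : Set b} (xs : List A) (g : A → List B) (f : B → S) →
                Σ (concatMap g xs) f ≈ Σ xs (λ x → Σ (g x) f)
  Σ-concatMap []       g f = refl
  Σ-concatMap (x ∷ xs) g f = trans (Σ-++ (g x) (concatMap g xs) f) (+-cong refl (Σ-concatMap xs g f))

  indicator : Bool → S
  indicator b = if b then 1# else 0#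

  δ : Word → Word → S
  δ y x = indicator (does (≡-dec _≟B_ y x))

  Σ-upTo-suc : ∀ N (f : ℕ → S) → Σ (upTo (suc N)) f ≡ f 0 + Σ (upTo N) (λ n → f (suc n))
  Σ-upTo-suc N f = ≡.cong (f 0 +_)
    (≡.trans (≡.cong (λ ns → Σ ns f) (≡.sym (map-applyUpTo (λ n → n) suc N))) (Σ-map (upTo N) suc f))

  Σ-upTo-indicator : ∀ {m} N → m < N → Σ (upTo N) (λ n → indicator (m ≡ᵇ n)) ≈ 1#
  Σ-upTo-indicator {zero}  (suc N) _         = begin
    Σ (upTo (suc N)) (λ n → indicator (0 ≡ᵇ n)) ≡⟨ Σ-upTo-suc N _ ⟩
    1# + Σ (upTo N) (λ _ → 0#)                ≈⟨ +-cong refl (Σ-zero (upTo N)) ⟩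
    1# + 0#                                   ≈⟨ +-identityʳ 1# ⟩
    1#                                        ∎
  Σ-upTo-indicator {suc m} (suc N) (s≤s m<N) = begin
    Σ (upTo (suc N)) (λ n → indicator (suc m ≡ᵇ n)) ≡⟨ Σ-upTo-suc N _ ⟩
    0# + Σ (upTo N) (λ n → indicator (m ≡ᵇ n))    ≈⟨ +-identityˡ _ ⟩
    Σ (upTo N) (λ n → indicator (m ≡ᵇ n))         ≈⟨ Σ-upTo-indicator N m<N ⟩
    1#                                            ∎

  Σ-wordsOfLength-split : ∀ n (f : Word → S) → Σ (wordsOfLength (suc n)) f
    ≈ Σ (wordsOfLength n) (λ w → f (false ∷ w)) + Σ (wordsOfLength n) (λ w → f (true ∷ w))
  Σ-wordsOfLength-split n f = trans (Σ-++ (map (false ∷_) ws) (map (true ∷_) ws) f)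
    (+-cong (reflexive (Σ-map ws (false ∷_) f)) (reflexive (Σ-map ws (true ∷_) f)))
    where ws = wordsOfLength n

  -- δ (b ∷ y) (b′ ∷ w) reduces to δ y w or to 0# as soon as b and b′ are known.
  Σ-wordsOfLength-δ : ∀ n y → Σ (wordsOfLength n) (δ y) ≈ indicator (length y ≡ᵇ n)
  Σ-wordsOfLength-δ zero    []          = +-identityʳ 1#
  Σ-wordsOfLength-δ zero    (b ∷ y)     = +-identityʳ 0#
  Σ-wordsOfLength-δ (suc n) []          = begin
    Σ (wordsOfLength (suc n)) (δ [])      ≈⟨ Σ-wordsOfLength-split n (δ []) ⟩
    Σ ws (λ _ → 0#) + Σ ws (λ _ → 0#)     ≈⟨ +-cong (Σ-zero ws) (Σ-zero ws) ⟩
    0# + 0#                               ≈⟨ +-identityʳ 0# ⟩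
    0#                                    ∎
    where ws = wordsOfLength n
  Σ-wordsOfLength-δ (suc n) (false ∷ y) = begin
    Σ (wordsOfLength (suc n)) (δ (false ∷ y)) ≈⟨ Σ-wordsOfLength-split n (δ (false ∷ y)) ⟩
    Σ ws (δ y) + Σ ws (λ _ → 0#)              ≈⟨ +-cong (Σ-wordsOfLength-δ n y) (Σ-zero ws) ⟩
    indicator (length y ≡ᵇ n) + 0#            ≈⟨ +-identityʳ _ ⟩
    indicator (length y ≡ᵇ n)                 ∎
    where ws = wordsOfLength n
  Σ-wordsOfLength-δ (suc n) (true ∷ y)  = begin
    Σ (wordsOfLength (suc n)) (δ (true ∷ y))  ≈⟨ Σ-wordsOfLength-split n (δ (true ∷ y)) ⟩
    Σ ws (λ _ → 0#) + Σ ws (δ y)              ≈⟨ +-cong (Σ-zero ws) (Σ-wordsOfLength-δ n y) ⟩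
    0# + indicator (length y ≡ᵇ n)            ≈⟨ +-identityˡ _ ⟩
    indicator (length y ≡ᵇ n)                 ∎
    where ws = wordsOfLength n

  wordsBelow : ℕ → List Word
  wordsBelow N = concatMap wordsOfLength (upTo N)

  Σ-wordsBelow-δ : ∀ N y → length y < N → Σ (wordsBelow N) (δ y) ≈ 1#
  Σ-wordsBelow-δ N y |y|<N = begin
    Σ (wordsBelow N) (δ y)                         ≈⟨ Σ-concatMap (upTo N) wordsOfLength (δ y) ⟩
    Σ (upTo N) (λ n → Σ (wordsOfLength n) (δ y))   ≈⟨ Σ-cong (upTo N) (λ n → Σ-wordsOfLength-δ n y) ⟩
    Σ (upTo N) (λ n → indicator (length y ≡ᵇ n))   ≈⟨ Σ-upTo-indicator N |y|<N ⟩
    1#                                             ∎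

  coeff-∷ : ∀ y a ψ x → coeff R ((y , a) ∷ ψ) x ≈ a * δ y x + coeff R ψ x
  coeff-∷ y a ψ x with ≡-dec _≟B_ y x
  ... | yes _ = +-cong (sym (*-identityʳ a)) refl
  ... | no  _ = trans (sym (+-identityˡ _)) (+-cong (sym (zeroʳ a)) refl)

  weight : D R → S
  weight ψ = Σ ψ proj₂

  Σ-wordsBelow-coeff : ∀ N ψ → lenBound R ψ < N → Σ (wordsBelow N) (coeff R ψ) ≈ weight ψ
  Σ-wordsBelow-coeff N []            _       = Σ-zero (wordsBelow N)
  Σ-wordsBelow-coeff N ((y , a) ∷ ψ) bound<N = begin
    Σ ws (coeff R ((y , a) ∷ ψ))               ≈⟨ Σ-cong ws (coeff-∷ y a ψ) ⟩
    Σ ws (λ x → a * δ y x + coeff R ψ x)       ≈⟨ Σ-+ ws _ _ ⟩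
    Σ ws (λ x → a * δ y x) + Σ ws (coeff R ψ)  ≈⟨ +-cong (Σ-distribˡ ws a (δ y)) (Σ-wordsBelow-coeff N ψ ψ<N) ⟩
    a * Σ ws (δ y) + weight ψ                  ≈⟨ +-cong (*-cong refl (Σ-wordsBelow-δ N y y<N)) refl ⟩
    a * 1# + weight ψ                          ≈⟨ +-cong (*-identityʳ a) refl ⟩
    a + weight ψ                               ∎
    where
    ws  = wordsBelow N
    y<N = m⊔n<o⇒m<o (length y) (lenBound R ψ) bound<N
    ψ<N = m⊔n<o⇒n<o (length y) (lenBound R ψ) bound<N

  totalSum≈weight : ∀ ψ → totalSum R ψ ≈ weight ψ
  totalSum≈weight ψ = begin
    totalSum R ψ                 ≡⟨ ≡.cong (sumS R) (≡.sym (map-concatMap (coeff R ψ) wordsOfLength (upTo N))) ⟩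
    Σ (wordsBelow N) (coeff R ψ) ≈⟨ Σ-wordsBelow-coeff N ψ (n<1+n (lenBound R ψ)) ⟩
    weight ψ                     ∎
    where N = suc (lenBound R ψ)

  weight-cong : ∀ ψ φ → _≈D_ R ψ φ → weight ψ ≈ weight φ
  weight-cong ψ φ ψ≈φ = begin
    weight ψ                     ≈⟨ Σ-wordsBelow-coeff N ψ (s≤s (m≤m⊔n _ _)) ⟨
    Σ (wordsBelow N) (coeff R ψ) ≈⟨ Σ-cong (wordsBelow N) ψ≈φ ⟩
    Σ (wordsBelow N) (coeff R φ) ≈⟨ Σ-wordsBelow-coeff N φ (s≤s (m≤n⊔m _ _)) ⟩
    weight φ                     ∎
    where N = suc (lenBound R ψ ⊔ℕ lenBound R φ)

  weight-⊗ : ∀ φ ψ → weight (_⊗_ R φ ψ) ≈ weight φ * weight ψ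
  weight-⊗ φ ψ = begin
    weight (_⊗_ R φ ψ)                             ≈⟨ Σ-concatMap φ _ proj₂ ⟩
    Σ φ (λ (x , a) → weight (map (λ (y , b) → (x ++ y , a * b)) ψ))
      ≈⟨ Σ-cong φ (λ (x , a) → trans (reflexive (Σ-map ψ _ proj₂)) (Σ-distribˡ ψ a proj₂)) ⟩
    Σ φ (λ p → proj₂ p * weight ψ)                 ≈⟨ Σ-distribʳ φ (weight ψ) proj₂ ⟩
    weight φ * weight ψ                            ∎

  weight≈1 : ∀ ψ → S₁ R ψ → weight ψ ≈ 1#
  weight≈1 ψ ψ∈S₁ = trans (sym (totalSum≈weight ψ)) ψ∈S₁

  S₁-resp-weight : ∀ ψ φ → weight ψ ≈ weight φ → S₁ R ψ → S₁ R φ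
  S₁-resp-weight ψ φ w ψ∈S₁ = begin
    totalSum R φ ≈⟨ totalSum≈weight φ ⟩
    weight φ     ≈⟨ w ⟨
    weight ψ     ≈⟨ weight≈1 ψ ψ∈S₁ ⟩
    1#           ∎

  S₁-isStateSpace : ¬ (1# ≈ 0#) → IsStateSpace R (S₁ R)
  S₁-isStateSpace 1≉0 = record
    { respects = λ ψ φ ψ≈φ → S₁-resp-weight ψ φ (weight-cong ψ φ ψ≈φ)
    ; tensorˡ  = λ ψ φ ψ∈S₁ → S₁-⇔ (_⊗_ R φ ψ) φ (weight-⊗-unitʳ φ ψ ψ∈S₁)
    ; tensorʳ  = λ ψ φ ψ∈S₁ → S₁-⇔ (_⊗_ R ψ φ) φ (weight-⊗-unitˡ ψ φ ψ∈S₁)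
    ; basis    = λ x → trans (totalSum≈weight (ket R x)) (+-identityʳ 1#)
    ; noZero   = λ ψ ψ≈0⃗ ψ∈S₁ → 1≉0 (begin
        1#         ≈⟨ weight≈1 ψ ψ∈S₁ ⟨
        weight ψ   ≈⟨ weight-cong ψ [] ψ≈0⃗ ⟩
        weight []  ∎)
    }
    where
    S₁-⇔ : ∀ ψ φ → weight ψ ≈ weight φ → S₁ R ψ ⇔ S₁ R φ
    S₁-⇔ ψ φ w = mk⇔ (S₁-resp-weight ψ φ w) (S₁-resp-weight φ ψ (sym w))

    weight-⊗-unitʳ : ∀ φ ψ → S₁ R ψ → weight (_⊗_ R φ ψ) ≈ weight φ
    weight-⊗-unitʳ φ ψ ψ∈S₁ = trans (weight-⊗ φ ψ) (trans (*-cong refl (weight≈1 ψ ψ∈S₁)) (*-identityʳ _))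

    weight-⊗-unitˡ : ∀ ψ φ → S₁ R ψ → weight (_⊗_ R ψ φ) ≈ weight φ
    weight-⊗-unitˡ ψ φ ψ∈S₁ = trans (weight-⊗ ψ φ) (trans (*-cong (weight≈1 ψ ψ∈S₁) refl) (*-identityˡ _))

mainTheorem10 : {c ℓ : Level} (R : CommutativeRing c ℓ) →
    ¬ (CommutativeRing._≈_ R (CommutativeRing.1# R) (CommutativeRing.0# R)) →
    IsStateSpace R (S₁ R)
mainTheorem10 = S₁-isStateSpace
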